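{- Let $T$ be a tree and $P$ a path in $T$ with distinct endpoints $u$ and $v$. Let $T_1$ (resp. $T_2$) be the connected component of $T \setminus (V(P)\setminus\{u,v\})$ containing $u$ (resp. $v$), and let $T' = T_1 \cup T_2 + uv$ be the tree obtained from $T_1$ and $T_2$ by adding the edge $uv$. Suppose $b(T') = p$. Then $b(T) \leq p+1$ unless $$ d(u,v) + 2\max_{x \in V(T)\setminus V(T_1\cup T_2)} d(P,x) \geq 2p+3. $$
   Context: $d$ denotes the graph distance in $T$, and $d(P,x)$ the distance from vertex $x$ to the nearest vertex of $P$. The burning number $b(G)$ of a graph $G$ is the least $k$ such that there are vertices $v_1,\dots,v_k$ with $\bigcup_{i=1}^{k} N_{k-i}[v_i] = V(G)$, where $N_r[v]$ is the set of vertices at distance at most $r$ from $v$ (equivalently, the number of steps of the burning process: at step 1 a vertex is set on fire, at each later step fire spreads to all neighbours of burning vertices and one new vertex is set on fire). -}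

module Defs where

open import Data.Nat using (ℕ; zero; suc; _+_; _*_; _∸_; _≤_; _<_)
open import Data.Fin using (Fin; toℕ)
open import Data.List using (List; []; _∷_; head; last; length)
open import Data.List.Membership.Propositional using (_∈_)
open import Data.List.Relation.Unary.Linked using (Linked)
open import Data.List.Relation.Unary.Unique.Propositional using (Unique)
open import Data.Maybe using (just)
open import Data.Product using (Σ; ∃; ∃-syntax; _×_)
open import Data.Sum using (_⊎_)
open import Data.Unit using (⊤)
open import Relation.Nullary using (¬_)
open import Relation.Binary.PropositionalEquality using (_≡_; _≢_)

Rel : ℕ → Set₁
Rel n = Fin n → Fin n → Set

module _ {n : ℕ} where

  data Walk (Adj : Rel n) (S : Fin n → Set) : Fin n → Fin n → ℕ → Set where
    here : ∀ {x} → S x → Walk Adj S x x 0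
    step : ∀ {x y z k} → S x → Adj x y → Walk Adj S y z k → Walk Adj S x z (suc k)

  Every : Fin n → Set
  Every _ = ⊤

  IsSimple : Rel n → Set
  IsSimple Adj = (∀ {x y} → Adj x y → Adj y x) × (∀ {x} → ¬ Adj x x)

  Connected : Rel n → Set
  Connected Adj = ∀ x y → ∃[ k ] Walk Adj Every x y k

  IsPath : Rel n → List (Fin n) → Fin n → Fin n → Set
  IsPath Adj P x y = Linked Adj P × Unique P × head P ≡ just x × last P ≡ just y

  HasCycle : Rel n → Set
  HasCycle Adj = Σ (List (Fin n)) λ C → Σ (Fin n) λ x → Σ (Fin n) λ y →
    IsPath Adj C x y × 3 ≤ length C × Adj y x

  IsTree : Rel n → Set
  IsTree Adj = IsSimple Adj × Connected Adj × ¬ HasCycle Adj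

  IsDist : Rel n → Fin n → Fin n → ℕ → Set
  IsDist Adj x y d = Walk Adj Every x y d × (∀ m → Walk Adj Every x y m → d ≤ m)

  IsDistToSet : Rel n → List (Fin n) → Fin n → ℕ → Set
  IsDistToSet Adj P x d =
    (∃[ w ] (w ∈ P × Walk Adj Every w x d)) ×
    (∀ w m → w ∈ P → Walk Adj Every w x m → d ≤ m)

  -- Burning a graph (vertex set S, adjacency Adj) in k steps: sources v₁..v_k
  -- (here indexed by i : Fin k, v_{i+1} = f i) in S with ⋃ N_{k-(i+1)}[f i] = S.
  Burns : Rel n → (Fin n → Set) → ℕ → Set
  Burns Adj S k = Σ (Fin k → Fin n) λ f → (∀ i → S (f i)) ×
    (∀ x → S x → ∃[ i ] ∃[ m ] (m ≤ k ∸ suc (toℕ i) × Walk Adj S (f i) x m))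

  BurningNumber : Rel n → (Fin n → Set) → ℕ → Set
  BurningNumber Adj S p = Burns Adj S p × (∀ k → k < p → ¬ Burns Adj S k)

  BurningNumber≤ : Rel n → (Fin n → Set) → ℕ → Set
  BurningNumber≤ Adj S q = ∃[ k ] (k ≤ q × Burns Adj S k)

  Interior : List (Fin n) → Fin n → Fin n → Fin n → Set
  Interior P u v x = x ∈ P × x ≢ u × x ≢ v

  -- vertex x lies in the component of T ∖ (V(P) ∖ {u,v}) containing w
  InComp : Rel n → List (Fin n) → Fin n → Fin n → Fin n → Fin n → Set
  InComp Adj P u v w x = ∃[ k ] Walk Adj (λ y → ¬ Interior P u v y) w x k

  InT12 : Rel n → List (Fin n) → Fin n → Fin n → Fin n → Set
  InT12 Adj P u v x = InComp Adj P u v u x ⊎ InComp Adj P u v v x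

  AdjT' : Rel n → List (Fin n) → Fin n → Fin n → Rel n
  AdjT' Adj P u v x y =
    (InT12 Adj P u v x × InT12 Adj P u v y × Adj x y) ⊎ ((x ≡ u × y ≡ v) ⊎ (x ≡ v × y ≡ u))

{-# OPTIONS --safe #-}

-- Keep the p sources of a burning of T′, now spreading in T, and add a first source c on P
-- that burns for p rounds. Let slack e = maxᵢ (rᵢ + 1 − d(fᵢ, e)), one more than the most
-- fire an old source has left on reaching e in T. Fire in T′ spreads the same way in T
-- unless it uses the edge uv; by symmetry assume slack v ≤ slack u. Fire crossing from v
-- to u is already produced at u, as slack u ≥ slack v. Fire crossing from u to v with m
-- rounds left forces slack u ≥ m + 2, so it is replaced by c, placed at distance
-- t = min(⌊d(u,v)/2⌋, p + 2 − slack u) from v. A vertex outside T₁ ∪ T₂ lies at distance h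
-- from an interior vertex of P, where d(u,v) + 2h ≤ 2p + 2; it is reached either by the
-- old fire through u or by c, which is no further from v than the midpoint of P.

module Submission where

open import Defs
open import Data.Nat using (ℕ; zero; suc; _+_; _*_; _∸_; _≤_; _<_; _≥_; z≤n; s≤s; s≤s⁻¹; ∣_-_∣; ⌊_/2⌋; ⌈_/2⌉; _⊔_; _⊓_)
open import Data.Nat.Properties
open import Data.Nat.Induction using (<-rec)
open import Data.Nat.Tactic.RingSolver using (solve-∀)
open import Data.Fin using (Fin; toℕ; zero; suc)
open import Data.Fin.Properties using (any?; toℕ<n) renaming (_≟_ to _≟ᶠ_)
open import Data.List using (List; []; _∷_; head; last; length)
open import Data.List.Membership.Propositional using (_∈_; _∉_; find; lose)
open import Data.List.Relation.Unary.Any using (here; there)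
import Data.List.Relation.Unary.Any as Any
open import Data.List.Relation.Unary.All using (All; []; _∷_; lookup)
open import Data.List.Relation.Unary.All.Properties using (¬Any⇒All¬)
open import Data.List.Relation.Unary.AllPairs using ([]; _∷_)
open import Data.List.Relation.Unary.Linked using (Linked; [-]; _∷_; _∷′_)
import Data.List.Relation.Unary.Linked as Linked
open import Data.List.Relation.Unary.Unique.Propositional using (Unique)
open import Data.Maybe using (just)
open import Data.Maybe.Relation.Binary.Connected as Maybe using (just)
open import Data.Maybe.Properties using (just-injective)
open import Data.Product using (∃; ∃-syntax; _×_; _,_; proj₁; proj₂)
open import Data.Sum using (_⊎_; inj₁; inj₂)
open import Data.Unit using (tt)
open import Data.Empty using (⊥-elim)
import Data.Vec.Functional as Vector
open import Function using (_∘_)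
open import Relation.Nullary using (¬_; Dec; yes; no)
open import Relation.Nullary.Decidable using (_×-dec_; map′; decidable-stable; ¬¬-excluded-middle)
open import Relation.Nullary.Negation using (¬¬-map)
open import Relation.Binary.PropositionalEquality

least : {Q : ℕ → Set} → (∀ m → Dec (Q m)) → ∃ Q → ∃[ m ] (Q m × (∀ k → Q k → m ≤ k))
least {Q} Q? (m , q) = <-rec Least search m q
  where
  Least : ℕ → Set
  Least m = Q m → ∃[ m′ ] (Q m′ × (∀ k → Q k → m′ ≤ k))
  search : ∀ m → (∀ {k} → k < m → Least k) → Least m
  search m rec q with anyUpTo? Q? m
  ... | yes (k , k<m , qk) = rec k<m qk
  ... | no none = m , q , λ k qk → ≮⇒≥ λ k<m → none (k , k<m , qk)

module _ {n : ℕ} {A : Rel n} where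

  infixr 5 _++ʷ_

  _++ʷ_ : ∀ {S a b c m k} → Walk A S a b m → Walk A S b c k → Walk A S a c (m + k)
  here _     ++ʷ W′ = W′
  step s e W ++ʷ W′ = step s e (W ++ʷ W′)

  castʷ : ∀ {S a a′ b b′ m m′} → a ≡ a′ → b ≡ b′ → m ≡ m′ → Walk A S a b m → Walk A S a′ b′ m′
  castʷ refl refl refl W = W

  snocʷ : ∀ {S a b c m} → Walk A S a b m → A b c → S c → Walk A S a c (suc m)
  snocʷ (here s)     e sc = step s e (here sc)
  snocʷ (step s e W) e′ sc = step s e (snocʷ W e′ sc)

  reverseʷ : (∀ {x y} → A x y → A y x) → ∀ {a b m} → Walk A Every a b m → Walk A Every b a m
  reverseʷ sym-A (here _)     = here tt
  reverseʷ sym-A (step _ e W) = snocʷ (reverseʷ sym-A W) (sym-A e) tt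

  shortest-avoids : ∀ {S : Fin n → Set} {P w x k} → (∀ {y} → y ∉ P → S y) →
    (∀ y m → y ∈ P → Walk A Every y x m → k ≤ m) → S w → Walk A Every w x k → Walk A S w x k
  shortest-avoids outside shortest s (here _) = here s
  shortest-avoids {k = suc k} outside shortest s (step _ e W) =
    step s e (shortest-avoids outside
      (λ y m y∈P W′ → ≤-trans (n≤1+n k) (shortest y m y∈P W′))
      (outside λ y∈P → 1+n≰n (shortest _ k y∈P W)) W)

module _ {n : ℕ} where

  dropTo : ∀ {x} (xs : List (Fin n)) → x ∈ xs → List (Fin n)
  dropTo (y ∷ ys) (here _)  = y ∷ ys
  dropTo (y ∷ ys) (there p) = dropTo ys p

  takeThrough : ∀ {x} (xs : List (Fin n)) → x ∈ xs → List (Fin n)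
  takeThrough (y ∷ _)  (here _)  = y ∷ []
  takeThrough (y ∷ ys) (there p) = y ∷ takeThrough ys p

  private
    last-∷ : ∀ {y z} {ys : List (Fin n)} → head ys ≡ just z → last (y ∷ ys) ≡ last ys
    last-∷ {ys = _ ∷ _} _ = refl

    head-takeThrough : ∀ {x y} ys (p : x ∈ y ∷ ys) → head (takeThrough (y ∷ ys) p) ≡ just y
    head-takeThrough _ (here _)  = refl
    head-takeThrough _ (there _) = refl

    All-takeThrough : ∀ {P : Fin n → Set} {x} xs (p : x ∈ xs) → All P xs → All P (takeThrough xs p)
    All-takeThrough (_ ∷ _)  (here _)  (a ∷ _)  = a ∷ []
    All-takeThrough (_ ∷ ys) (there p) (a ∷ as) = a ∷ All-takeThrough ys p as

  module _ {A : Rel n} where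
    open import Data.List.Membership.DecPropositional (_≟ᶠ_ {n}) using (_∈?_)

    dropTo-path : ∀ {x b} xs (x∈ : x ∈ xs) → Linked A xs → Unique xs → last xs ≡ just b →
                  IsPath A (dropTo xs x∈) x b
    dropTo-path (y ∷ ys) (here refl) L U la = L , U , refl , la
    dropTo-path (y ∷ ys@(_ ∷ _)) (there p) L (_ ∷ U) la = dropTo-path ys p (Linked.tail L) U la

    walk⇒path : ∀ {S a b m} → Walk A S a b m → ∃[ Q ] IsPath A Q a b
    walk⇒path {a = a} (here _) = a ∷ [] , [-] , [] ∷ [] , refl , refl
    walk⇒path {a = a} (step _ e W) with walk⇒path W
    ... | [] , _ , _ , () , _
    ... | Q@(_ ∷ _) , L , U , refl , la with a ∈? Q
    ...   | yes a∈Q = dropTo Q a∈Q , dropTo-path Q a∈Q L U la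
    ...   | no a∉Q  = a ∷ Q , e ∷ L , ¬Any⇒All¬ Q a∉Q ∷ U , refl , la

    takeThrough-path : ∀ {a b x} xs (x∈ : x ∈ xs) → IsPath A xs a b → IsPath A (takeThrough xs x∈) a x
    takeThrough-path (y ∷ _) (here refl) (_ , _ , refl , _) = [-] , [] ∷ [] , refl , refl
    takeThrough-path (y ∷ z ∷ zs) (there p) (e ∷ L , a ∷ U , refl , la)
      with takeThrough-path (z ∷ zs) p (L , U , refl , la)
    ... | L′ , U′ , _ , la′ =
      subst (Maybe.Connected A (just y)) (sym (head-takeThrough zs p)) (just e) ∷′ L′ ,
      All-takeThrough (z ∷ zs) p a ∷ U′ , refl , trans (last-∷ (head-takeThrough zs p)) la′

head⇒∈ : ∀ {n} {a : Fin n} xs → head xs ≡ just a → a ∈ xs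
head⇒∈ (_ ∷ _) refl = here refl

last⇒∈ : ∀ {n} {b : Fin n} xs → last xs ≡ just b → b ∈ xs
last⇒∈ (_ ∷ [])     eq = here (sym (just-injective eq))
last⇒∈ (_ ∷ y ∷ ys) eq = there (last⇒∈ (y ∷ ys) eq)

module Tree {n : ℕ} {T : Rel n} (tree : IsTree T) where
  open import Data.List.Membership.DecPropositional (_≟ᶠ_ {n}) using (_∈?_)

  symmetric : ∀ {x y} → T x y → T y x
  symmetric = proj₁ (proj₁ tree)

  irreflexive : ∀ {x} → ¬ T x x
  irreflexive = proj₂ (proj₁ tree)

  connected : Connected T
  connected = proj₁ (proj₂ tree)

  acyclic : ¬ HasCycle T
  acyclic = proj₂ (proj₂ tree)

  adj? : ∀ x y → Dec (T x y)
  adj? x y with walk⇒path (proj₂ (connected x y))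
  ... | [] , _ , _ , () , _
  ... | _ ∷ [] , _ , _ , refl , refl = no irreflexive
  ... | _ ∷ _ ∷ [] , e ∷ _ , _ , refl , refl = yes e
  ... | C@(_ ∷ _ ∷ _ ∷ _) , isC =
    no λ e → acyclic (C , x , y , isC , s≤s (s≤s (s≤s z≤n)) , symmetric e)

  walk? : ∀ m a b → Dec (Walk T Every a b m)
  walk? zero a b with a ≟ᶠ b
  ... | yes refl = yes (here tt)
  ... | no a≢b   = no λ { (here _) → a≢b refl }
  walk? (suc m) a b with any? (λ y → adj? a y ×-dec walk? m y b)
  ... | yes (_ , e , W) = yes (step tt e W)
  ... | no ∄            = no λ { (step _ e W) → ∄ (_ , e , W) }

  -- The first step q → w of the walk either follows the path, extends it backwards to a
  -- longer path, or lands further along it and closes a cycle.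
  path-shortest : ∀ {a b m} Q → IsPath T Q a b → Walk T Every a b m → length Q ∸ 1 ≤ m
  path-shortest [] (_ , _ , () , _) _
  path-shortest (_ ∷ []) _ _ = z≤n
  path-shortest (q ∷ Q@(_ ∷ _)) (_ , q∉Q ∷ _ , refl , la) (here _) =
    ⊥-elim (lookup q∉Q (last⇒∈ Q la) refl)
  path-shortest (q ∷ Q@(q₁ ∷ _)) isP@(e₀ ∷ L , q∉Q ∷ U , refl , la) (step {y = w} _ e W)
    with w ≟ᶠ q₁ | w ∈? q ∷ Q
  ... | yes refl | _ = s≤s (path-shortest Q (L , U , refl , la) W)
  ... | no _ | no w∉ = ≤-trans (n≤1+n _) (m≤n⇒m≤1+n
        (path-shortest (w ∷ q ∷ Q) (symmetric e ∷ e₀ ∷ L , ¬Any⇒All¬ _ w∉ ∷ q∉Q ∷ U , refl , la) W))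
  ... | no _ | yes (here refl) = ⊥-elim (irreflexive e)
  ... | no w≢q₁ | yes (there (here refl)) = ⊥-elim (w≢q₁ refl)
  ... | no _ | yes w∈@(there (there w∈′)) =
    ⊥-elim (acyclic (takeThrough (q ∷ Q) w∈ , q , w , takeThrough-path (q ∷ Q) w∈ isP ,
                     s≤s (s≤s (nonempty w∈′)) , symmetric e))
    where
    nonempty : ∀ {x} {xs : List (Fin n)} (p : x ∈ xs) → 0 < length (takeThrough xs p)
    nonempty (here _)  = s≤s z≤n
    nonempty (there _) = s≤s z≤n

  dist-exists : ∀ x y → ∃[ d ] IsDist T x y d
  dist-exists x y = least (λ m → walk? m x y) (connected x y)

  distToSet-exists : ∀ {P w} → w ∈ P → ∀ x → ∃[ d ] IsDistToSet T P x d
  distToSet-exists {P} {w} w∈P x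
    with least (λ m → Any.any? (λ w′ → walk? m w′ x) P) (_ , lose w∈P (proj₂ (connected w x)))
  ... | d , reach , shortest = d , find reach , λ w′ m w′∈P W → shortest m (lose w′∈P W)

  Covered : ∀ {k} → (Fin k → Fin n) → Fin n → Set
  Covered {k} g x = ∃[ i ] ∃[ m ] (m ≤ k ∸ suc (toℕ i) × Walk T Every (g i) x m)

  Covered? : ∀ {k} (g : Fin k → Fin n) x → Dec (Covered g x)
  Covered? {k} g x = any? λ i →
    map′ (λ (m , m<r , W) → m , ≤-pred m<r , W) (λ (m , m≤r , W) → m , s≤s m≤r , W)
         (anyUpTo? (λ m → walk? m (g i) x) (suc (k ∸ suc (toℕ i))))

∣o∸m-o∸n∣≡∣m-n∣ : ∀ {m n o} → m ≤ o → n ≤ o → ∣ o ∸ m - o ∸ n ∣ ≡ ∣ m - n ∣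
∣o∸m-o∸n∣≡∣m-n∣ {m} {n} {o} m≤o n≤o = begin
  ∣ o ∸ m - o ∸ n ∣                 ≡⟨ sym (∣m+n-m+o∣≡∣n-o∣ (m + n) (o ∸ m) (o ∸ n)) ⟩
  ∣ m + n + (o ∸ m) - m + n + (o ∸ n) ∣ ≡⟨ cong₂ ∣_-_∣ (shift m≤o n) (trans (cong (_+ (o ∸ n)) (+-comm m n)) (shift n≤o m)) ⟩
  ∣ n + o - m + o ∣                   ≡⟨ cong₂ ∣_-_∣ (+-comm n o) (+-comm m o) ⟩
  ∣ o + n - o + m ∣                   ≡⟨ ∣m+n-m+o∣≡∣n-o∣ o n m ⟩
  ∣ n - m ∣                          ≡⟨ ∣-∣-comm n m ⟩
  ∣ m - n ∣                          ∎
  where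
  open ≡-Reasoning
  shift : ∀ {i L} → i ≤ L → ∀ j → i + j + (L ∸ i) ≡ j + L
  shift {i} {L} i≤L j = begin
    i + j + (L ∸ i)   ≡⟨ cong (_+ (L ∸ i)) (+-comm i j) ⟩
    j + i + (L ∸ i)   ≡⟨ +-assoc j i (L ∸ i) ⟩
    j + (i + (L ∸ i)) ≡⟨ cong (j +_) (m+[n∸m]≡n i≤L) ⟩
    j + L             ∎

record Segment {n : ℕ} (T : Rel n) (a b : Fin n) (L : ℕ) : Set where
  field
    at      : ℕ → Fin n
    at-0    : at 0 ≡ a
    at-L    : at L ≡ b
    between : ∀ {i j} → i ≤ L → j ≤ L → Walk T Every (at i) (at j) ∣ i - j ∣

module _ {n : ℕ} {T : Rel n} where

  Segment-reverse : ∀ {a b L} → Segment T a b L → Segment T b a L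
  Segment-reverse {L = L} σ = record
    { at      = λ i → at (L ∸ i)
    ; at-0    = at-L
    ; at-L    = trans (cong at (n∸n≡0 L)) at-0
    ; between = λ {i} {j} i≤L j≤L →
        castʷ refl refl (∣o∸m-o∸n∣≡∣m-n∣ i≤L j≤L) (between (m∸n≤m L i) (m∸n≤m L j))
    }
    where open Segment σ

  nth : Fin n → List (Fin n) → ℕ → Fin n
  nth d []       _       = d
  nth d (x ∷ _)  zero    = x
  nth d (_ ∷ xs) (suc k) = nth d xs k

  nth-walk : ∀ d xs {i j} → Linked T xs → i ≤ j → j < length xs →
             Walk T Every (nth d xs i) (nth d xs j) (j ∸ i)
  nth-walk d (x ∷ xs)     {zero}  {zero}  _       _         _         = here tt
  nth-walk d (x ∷ [])     {zero}  {suc j} _       _         (s≤s ())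
  nth-walk d (x ∷ y ∷ xs) {zero}  {suc j} (e ∷ L) _         (s≤s j<)  =
    step tt e (nth-walk d (y ∷ xs) L z≤n j<)
  nth-walk d (x ∷ xs)     {suc i} {suc j} L       (s≤s i≤j) (s≤s j<)  =
    nth-walk d xs (Linked.tail L) i≤j j<

  private
    nth-last : ∀ d {b} xs → last xs ≡ just b → nth d xs (length xs ∸ 1) ≡ b
    nth-last d (x ∷ [])     eq = just-injective eq
    nth-last d (x ∷ y ∷ xs) eq = nth-last d (y ∷ xs) eq

  path⇒Segment : (∀ {x y} → T x y → T y x) → ∀ {P a b} → IsPath T P a b →
                 Segment T a b (length P ∸ 1)
  path⇒Segment symmetric {x ∷ xs} {a} (L , _ , refl , la) = record
    { at      = nth a (x ∷ xs)
    ; at-0    = refl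
    ; at-L    = nth-last a (x ∷ xs) la
    ; between = between
    }
    where
    between : ∀ {i j} → i ≤ length xs → j ≤ length xs →
              Walk T Every (nth a (x ∷ xs) i) (nth a (x ∷ xs) j) ∣ i - j ∣
    between {i} {j} i≤ j≤ with ≤-total i j
    ... | inj₁ i≤j = castʷ refl refl (sym (m≤n⇒∣m-n∣≡n∸m i≤j)) (nth-walk a (x ∷ xs) L i≤j (s≤s j≤))
    ... | inj₂ j≤i = castʷ refl refl (sym (m≤n⇒∣n-m∣≡n∸m j≤i))
                       (reverseʷ symmetric (nth-walk a (x ∷ xs) L j≤i (s≤s i≤)))

  Detour : Fin n → Fin n → Fin n → Fin n → ℕ → Set
  Detour s t a b m = ∃[ m₁ ] ∃[ m₂ ] (m₁ + suc m₂ ≤ m × Walk T Every a s m₁ × Walk T Every t b m₂)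

  ReachWithEdge : Fin n → Fin n → Fin n → Fin n → ℕ → Set
  ReachWithEdge s t a b m =
    (∃[ k ] (k ≤ m × Walk T Every a b k)) ⊎ Detour s t a b m ⊎ Detour t s a b m

  ReachWithEdge-swap : ∀ {s t a b m} → ReachWithEdge s t a b m → ReachWithEdge t s a b m
  ReachWithEdge-swap (inj₁ w)        = inj₁ w
  ReachWithEdge-swap (inj₂ (inj₁ d)) = inj₂ (inj₂ d)
  ReachWithEdge-swap (inj₂ (inj₂ d)) = inj₂ (inj₁ d)

  ReachWithEdge-step : ∀ {s t a a′ b m} → T a a′ → ReachWithEdge s t a′ b m → ReachWithEdge s t a b (suc m)
  ReachWithEdge-step e (inj₁ (k , k≤m , W)) = inj₁ (suc k , s≤s k≤m , step tt e W)
  ReachWithEdge-step e (inj₂ (inj₁ (m₁ , m₂ , le , W₁ , W₂))) =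
    inj₂ (inj₁ (suc m₁ , m₂ , s≤s le , step tt e W₁ , W₂))
  ReachWithEdge-step e (inj₂ (inj₂ (m₁ , m₂ , le , W₁ , W₂))) =
    inj₂ (inj₂ (suc m₁ , m₂ , s≤s le , step tt e W₁ , W₂))

  ReachWithEdge-cross : ∀ {s t b m} → ReachWithEdge s t t b m → ReachWithEdge s t s b (suc m)
  ReachWithEdge-cross (inj₁ (k , k≤m , W)) = inj₂ (inj₁ (0 , k , s≤s k≤m , here tt , W))
  ReachWithEdge-cross (inj₂ (inj₁ (m₁ , m₂ , le , _ , W₂))) =
    inj₂ (inj₁ (0 , m₂ , m≤n⇒m≤1+n (≤-trans (m≤n+m (suc m₂) m₁) le) , here tt , W₂))
  ReachWithEdge-cross (inj₂ (inj₂ (m₁ , m₂ , le , _ , W₂))) =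
    inj₁ (m₂ , m≤n⇒m≤1+n (≤-trans (≤-trans (n≤1+n m₂) (m≤n+m (suc m₂) m₁)) le) , W₂)

  AdjT′-walk⇒ReachWithEdge : ∀ {P u v S a b m} → Walk (AdjT' T P u v) S a b m → ReachWithEdge u v a b m
  AdjT′-walk⇒ReachWithEdge (here _) = inj₁ (0 , z≤n , here tt)
  AdjT′-walk⇒ReachWithEdge (step _ (inj₁ (_ , _ , e)) W) =
    ReachWithEdge-step e (AdjT′-walk⇒ReachWithEdge W)
  AdjT′-walk⇒ReachWithEdge (step _ (inj₂ (inj₁ (refl , refl))) W) =
    ReachWithEdge-cross (AdjT′-walk⇒ReachWithEdge W)
  AdjT′-walk⇒ReachWithEdge (step _ (inj₂ (inj₂ (refl , refl))) W) =
    ReachWithEdge-swap (ReachWithEdge-cross (ReachWithEdge-swap (AdjT′-walk⇒ReachWithEdge W)))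

  path⇒Segment-∈ : ∀ (symmetric : ∀ {x y} → T x y → T y x) {P a b w} (isP : IsPath T P a b) → w ∈ P →
                   ∃[ k ] (k ≤ length P ∸ 1 × Segment.at (path⇒Segment symmetric isP) k ≡ w)
  path⇒Segment-∈ _ {x ∷ xs} {a} (_ , _ , refl , _) w∈ = position (x ∷ xs) w∈
    where
    position : ∀ {w} ys → w ∈ ys → ∃[ k ] (k ≤ length ys ∸ 1 × nth a ys k ≡ w)
    position (y ∷ ys) (here refl) = 0 , z≤n , refl
    position (y ∷ ys@(_ ∷ _)) (there w∈) with position ys w∈
    ... | k , k≤ , eq = suc k , s≤s k≤ , eq

maxᶠ : ∀ {k} → (Fin k → ℕ) → ℕ
maxᶠ {zero}  g = 0
maxᶠ {suc k} g = g zero ⊔ maxᶠ (g ∘ suc)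

≤-maxᶠ : ∀ {k} (g : Fin k → ℕ) i → g i ≤ maxᶠ g
≤-maxᶠ g zero    = m≤m⊔n _ _
≤-maxᶠ g (suc i) = ≤-trans (≤-maxᶠ (g ∘ suc) i) (m≤n⊔m _ _)

maxᶠ-≤ : ∀ {k} (g : Fin k → ℕ) {b} → (∀ i → g i ≤ b) → maxᶠ g ≤ b
maxᶠ-≤ {zero}  g g≤b = z≤n
maxᶠ-≤ {suc k} g g≤b = ⊔-lub (g≤b zero) (maxᶠ-≤ (g ∘ suc) (g≤b ∘ suc))

maxᶠ-attained : ∀ {k} (g : Fin k → ℕ) → 0 < maxᶠ g → ∃[ i ] (maxᶠ g ≡ g i)
maxᶠ-attained {suc k} g 0<max with ⊔-sel (g zero) (maxᶠ (g ∘ suc))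
... | inj₁ eq = zero , eq
... | inj₂ eq with maxᶠ-attained (g ∘ suc) (<-≤-trans 0<max (≤-reflexive eq))
...   | i , eq′ = suc i , trans eq eq′

2*⌊n/2⌋≤n : ∀ n → 2 * ⌊ n /2⌋ ≤ n
2*⌊n/2⌋≤n n = begin
  ⌊ n /2⌋ + (⌊ n /2⌋ + 0) ≤⟨ +-monoʳ-≤ ⌊ n /2⌋ (≤-trans (≤-reflexive (+-identityʳ _)) (⌊n/2⌋≤⌈n/2⌉ n)) ⟩
  ⌊ n /2⌋ + ⌈ n /2⌉       ≡⟨ ⌊n/2⌋+⌈n/2⌉≡n n ⟩
  n                       ∎
  where open ≤-Reasoning

2*⌈n/2⌉≤1+n : ∀ n → 2 * ⌈ n /2⌉ ≤ suc n
2*⌈n/2⌉≤1+n n = 2*⌊n/2⌋≤n (suc n)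

n∸⌊n/2⌋≡⌈n/2⌉ : ∀ n → n ∸ ⌊ n /2⌋ ≡ ⌈ n /2⌉
n∸⌊n/2⌋≡⌈n/2⌉ n = begin
  n ∸ ⌊ n /2⌋                 ≡⟨ cong (_∸ ⌊ n /2⌋) (sym (⌊n/2⌋+⌈n/2⌉≡n n)) ⟩
  ⌊ n /2⌋ + ⌈ n /2⌉ ∸ ⌊ n /2⌋ ≡⟨ m+n∸m≡n ⌊ n /2⌋ ⌈ n /2⌉ ⟩
  ⌈ n /2⌉                     ∎
  where open ≡-Reasoning

2*m≤1+2*n⇒m≤n : ∀ {m n} → 2 * m ≤ suc (2 * n) → m ≤ n
2*m≤1+2*n⇒m≤n {m} {n} le = s≤s⁻¹ (*-cancelˡ-< 2 m (suc n) (≤-trans (s≤s le) (≤-reflexive (sym (*-suc 2 n)))))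

m<n∸o⇒o+m<n : ∀ {m n o} → m < n ∸ o → o + m < n
m<n∸o⇒o+m<n {m} {n} {o} lt = begin-strict
  o + m ≡⟨ +-comm o m ⟩
  m + o <⟨ m≤o∸n⇒m+n≤o (suc m) (<⇒≤ (m∸n≢0⇒n<m (λ eq → n≮0 (subst (m <_) eq lt)))) lt ⟩
  n     ∎
  where open ≤-Reasoning

m≤n⇒n∸m+o≤p : ∀ {m n o p} → m ≤ n → n + o ≤ p + m → n ∸ m + o ≤ p
m≤n⇒n∸m+o≤p {m} {n} {o} {p} m≤n le = +-cancelʳ-≤ m _ _ (begin
  n ∸ m + o + m   ≡⟨ +-assoc (n ∸ m) o m ⟩
  n ∸ m + (o + m) ≡⟨ cong (n ∸ m +_) (+-comm o m) ⟩
  n ∸ m + (m + o) ≡⟨ sym (+-assoc (n ∸ m) m o) ⟩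
  n ∸ m + m + o   ≡⟨ cong (_+ o) (m∸n+n≡m m≤n) ⟩
  n + o           ≤⟨ le ⟩
  p + m           ∎)
  where open ≤-Reasoning

∣m-n∣+o≤p : ∀ {m n o p} → m + o ≤ p + n → n + o ≤ p + m → ∣ m - n ∣ + o ≤ p
∣m-n∣+o≤p {m} {n} m+o≤ n+o≤ with ≤-total m n
... | inj₁ m≤n rewrite m≤n⇒∣m-n∣≡n∸m m≤n = m≤n⇒n∸m+o≤p m≤n n+o≤
... | inj₂ n≤m rewrite m≤n⇒∣n-m∣≡n∸m n≤m = m≤n⇒n∸m+o≤p n≤m m+o≤

private
  half-budget : ∀ {n h p} → n + 2 * h ≤ 2 * p + 2 → ⌈ n /2⌉ + h ≤ suc p
  half-budget {n} {h} {p} le = 2*m≤1+2*n⇒m≤n (begin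
    2 * (⌈ n /2⌉ + h)     ≡⟨ *-distribˡ-+ 2 ⌈ n /2⌉ h ⟩
    2 * ⌈ n /2⌉ + 2 * h   ≤⟨ +-monoˡ-≤ (2 * h) (2*⌈n/2⌉≤1+n n) ⟩
    suc (n + 2 * h)       ≤⟨ s≤s le ⟩
    suc (2 * p + 2)       ≡⟨ cong suc (r p) ⟩
    suc (2 * suc p)       ∎)
    where
    open ≤-Reasoning
    r : ∀ p → 2 * p + 2 ≡ 2 * suc p
    r = solve-∀

  far-from-end : ∀ {k h p s t} → k < s + t → 2 * t ≤ s + t → s + t + 2 * h ≤ 2 * p + 2 → k + h ≤ p + s
  far-from-end {k} {h} {p} {s} {t} k< 2t≤ le = *-cancelˡ-≤ 2 (+-cancelʳ-≤ 2 _ _ (begin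
    2 * (k + h) + 2               ≡⟨ r₁ k h ⟩
    2 * suc k + 2 * h             ≤⟨ +-monoˡ-≤ (2 * h) (*-monoʳ-≤ 2 k<) ⟩
    2 * (s + t) + 2 * h           ≡⟨ r₂ s t h ⟩
    2 * s + (2 * t + 2 * h)       ≤⟨ +-monoʳ-≤ (2 * s) (+-monoˡ-≤ (2 * h) 2t≤) ⟩
    2 * s + (s + t + 2 * h)       ≤⟨ +-monoʳ-≤ (2 * s) le ⟩
    2 * s + (2 * p + 2)           ≡⟨ r₃ s p ⟩
    2 * (p + s) + 2               ∎))
    where
    open ≤-Reasoning
    r₁ : ∀ k h → 2 * (k + h) + 2 ≡ 2 * suc k + 2 * h
    r₁ = solve-∀
    r₂ : ∀ s t h → 2 * (s + t) + 2 * h ≡ 2 * s + (2 * t + 2 * h)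
    r₂ = solve-∀
    r₃ : ∀ s p → 2 * s + (2 * p + 2) ≡ 2 * (p + s) + 2
    r₃ = solve-∀

  near-start : ∀ {k h p s t τ} → t + τ ≡ p + 2 → τ ≤ k + h → s + t + 2 * h ≤ 2 * p + 2 → s + h ≤ p + k
  near-start {k} {h} {p} {s} {t} {τ} t+τ τ≤ le = +-cancelʳ-≤ (t + τ) _ _ (begin
    s + h + (t + τ)       ≡⟨ r₁ s h t τ ⟩
    s + t + h + τ         ≤⟨ +-monoʳ-≤ (s + t + h) τ≤ ⟩
    s + t + h + (k + h)   ≡⟨ r₂ s t h k ⟩
    s + t + 2 * h + k     ≤⟨ +-monoˡ-≤ k le ⟩
    2 * p + 2 + k         ≡⟨ r₃ p k ⟩
    p + k + (p + 2)       ≡⟨ cong (p + k +_) (sym t+τ) ⟩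
    p + k + (t + τ)       ∎)
    where
    open ≤-Reasoning
    r₁ : ∀ s h t τ → s + h + (t + τ) ≡ s + t + h + τ
    r₁ = solve-∀
    r₂ : ∀ s t h k → s + t + h + (k + h) ≡ s + t + 2 * h + k
    r₂ = solve-∀
    r₃ : ∀ p k → 2 * p + 2 + k ≡ p + k + (p + 2)
    r₃ = solve-∀

offset-crossing : ∀ {p τ t m} → t ≤ p + 2 ∸ τ → suc m < τ → τ ≤ p + 2 → t + m ≤ p
offset-crossing {p} {τ} {t} {m} t≤ m<τ τ≤ = +-cancelʳ-≤ 2 _ _ (begin
  t + m + 2         ≡⟨ +-assoc t m 2 ⟩
  t + (m + 2)       ≡⟨ cong (t +_) (+-comm m 2) ⟩
  t + suc (suc m)   ≤⟨ +-mono-≤ t≤ m<τ ⟩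
  p + 2 ∸ τ + τ     ≡⟨ m∸n+n≡m τ≤ ⟩
  p + 2             ∎)
  where open ≤-Reasoning

offset-offpath : ∀ {L p τ k h} → 0 < k → k < L → L + 2 * h ≤ 2 * p + 2 → τ ≤ p + 2 →
                 k + h < τ ⊎ ∣ L ∸ (⌊ L /2⌋ ⊓ (p + 2 ∸ τ)) - k ∣ + h ≤ p
offset-offpath {L} {p} {τ} {k} {h} 0<k k<L budget τ≤ with suc (k + h) ≤? τ
... | yes near = inj₁ near
... | no far = inj₂ (∣m-n∣+o≤p {s} {k} (centre-side (⊓-sel ⌊ L /2⌋ (p + 2 ∸ τ)))
                               (far-from-end {s = s} (subst (k <_) (sym s+t≡L) k<L)
                                             (subst (2 * t ≤_) (sym s+t≡L) 2t≤L) budget′))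
  where
  t = ⌊ L /2⌋ ⊓ (p + 2 ∸ τ)
  s = L ∸ t
  2t≤L : 2 * t ≤ L
  2t≤L = ≤-trans (*-monoʳ-≤ 2 (m⊓n≤m ⌊ L /2⌋ _)) (2*⌊n/2⌋≤n L)
  s+t≡L : s + t ≡ L
  s+t≡L = m∸n+n≡m (≤-trans (m⊓n≤m ⌊ L /2⌋ _) (⌊n/2⌋≤n L))
  budget′ : s + t + 2 * h ≤ 2 * p + 2
  budget′ = subst (λ l → l + 2 * h ≤ 2 * p + 2) (sym s+t≡L) budget
  centre-side : t ≡ ⌊ L /2⌋ ⊎ t ≡ p + 2 ∸ τ → s + h ≤ p + k
  centre-side (inj₁ t≡) = begin
    s + h          ≡⟨ cong (λ t → L ∸ t + h) t≡ ⟩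
    L ∸ ⌊ L /2⌋ + h ≡⟨ cong (_+ h) (n∸⌊n/2⌋≡⌈n/2⌉ L) ⟩
    ⌈ L /2⌉ + h    ≤⟨ half-budget {L} budget ⟩
    suc p          ≡⟨ +-comm 1 p ⟩
    p + 1          ≤⟨ +-monoʳ-≤ p 0<k ⟩
    p + k          ∎
    where open ≤-Reasoning
  centre-side (inj₂ t≡) = near-start (trans (cong (_+ τ) t≡) (m∸n+n≡m τ≤)) (s≤s⁻¹ (≰⇒> far)) budget′

module Reburning {n : ℕ} {T : Rel n} (tree : IsTree T) {p : ℕ} (f : Fin p → Fin n) where
  open Tree tree

  radius : Fin p → ℕ
  radius i = p ∸ suc (toℕ i)

  dist : Fin n → Fin n → ℕ
  dist x y = proj₁ (dist-exists x y)

  slack : Fin n → ℕ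
  slack e = maxᶠ λ i → suc (radius i) ∸ dist (f i) e

  slack≤p : ∀ e → slack e ≤ p
  slack≤p e = maxᶠ-≤ _ λ i → ≤-trans (m∸n≤m _ (dist (f i) e)) (∸-monoʳ-< (s≤s z≤n) (toℕ<n i))

  slack-covers : ∀ {e x ℓ} → Walk T Every e x ℓ → ℓ < slack e → Covered f x
  slack-covers {e} W ℓ<slack with maxᶠ-attained _ (≤-<-trans z≤n ℓ<slack)
  ... | i , slack≡ = i , _ , s≤s⁻¹ (m<n∸o⇒o+m<n (<-≤-trans ℓ<slack (≤-reflexive slack≡))) ,
                     proj₁ (proj₂ (dist-exists (f i) e)) ++ʷ W

  slack-crossing : ∀ {i e m₁ m₂} → Walk T Every (f i) e m₁ → m₁ + suc m₂ ≤ radius i → suc m₂ < slack e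
  slack-crossing {i} {e} {m₁} {m₂} W le = ≤-trans (m+n≤o⇒m≤o∸n (suc (suc m₂)) (s≤s (begin
    suc m₂ + dist (f i) e ≡⟨ +-comm (suc m₂) _ ⟩
    dist (f i) e + suc m₂ ≤⟨ +-monoˡ-≤ (suc m₂) (proj₂ (proj₂ (dist-exists (f i) e)) m₁ W) ⟩
    m₁ + suc m₂           ≤⟨ le ⟩
    radius i              ∎)))
    (≤-maxᶠ (λ i → suc (radius i) ∸ dist (f i) e) i)
    where open ≤-Reasoning

  module _ {a b L} (σ : Segment T a b L) where
    open Segment σ

    OffPath : Fin n → Set
    OffPath x = ∃[ k ] ∃[ h ] (0 < k × k < L × L + 2 * h ≤ 2 * p + 2 × Walk T Every (at k) x h)

    Situation : Fin n → Set
    Situation x = Covered f x ⊎ (∃[ i ] Detour {T = T} a b (f i) x (radius i)) ⊎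
                  (∃[ i ] Detour {T = T} b a (f i) x (radius i)) ⊎ OffPath x

    burns-with-centre : slack b ≤ slack a → (∀ x → ¬ ¬ Situation x) → Burns T Every (suc p)
    burns-with-centre b≤a situation =
      c Vector.∷ f , (λ _ → tt) , λ x _ →
        decidable-stable (Covered? (c Vector.∷ f) x) (¬¬-map covers (situation x))
      where
      t = ⌊ L /2⌋ ⊓ (p + 2 ∸ slack a)
      c = at (L ∸ t)

      slack≤p+2 : ∀ e → slack e ≤ p + 2
      slack≤p+2 e = ≤-trans (slack≤p e) (m≤m+n p 2)

      centre-to-b : Walk T Every c b t
      centre-to-b = castʷ refl at-L
        (trans (m≤n⇒∣m-n∣≡n∸m (m∸n≤m L t)) (m∸[m∸n]≡n (≤-trans (m⊓n≤m ⌊ L /2⌋ _) (⌊n/2⌋≤n L))))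
        (between (m∸n≤m L t) ≤-refl)

      by-centre : ∀ {x m} → Walk T Every c x m → m ≤ p → Covered (c Vector.∷ f) x
      by-centre W m≤p = zero , _ , m≤p , W

      by-f : ∀ {x} → Covered f x → Covered (c Vector.∷ f) x
      by-f (i , m , m≤r , W) = suc i , m , m≤r , W

      covers : ∀ {x} → Situation x → Covered (c Vector.∷ f) x
      covers (inj₁ cov) = by-f cov
      covers (inj₂ (inj₁ (_ , _ , _ , le , W₁ , W₂))) =
        by-centre (centre-to-b ++ʷ W₂)
                  (offset-crossing (m⊓n≤n ⌊ L /2⌋ _) (slack-crossing W₁ le) (slack≤p+2 a))
      covers (inj₂ (inj₂ (inj₁ (_ , _ , _ , le , W₁ , W₂)))) =
        by-f (slack-covers W₂ (≤-trans (≤-trans (n≤1+n _) (slack-crossing W₁ le)) b≤a))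
      covers (inj₂ (inj₂ (inj₂ (k , h , 0<k , k<L , budget , W))))
        with offset-offpath 0<k k<L budget (slack≤p+2 a)
      ... | inj₁ near-a = by-f (slack-covers (castʷ at-0 refl refl (between z≤n (<⇒≤ k<L)) ++ʷ W) near-a)
      ... | inj₂ near-c = by-centre (between (m∸n≤m L t) (<⇒≤ k<L) ++ʷ W) near-c

  Situation-reverse : ∀ {a b L} {σ : Segment T a b L} {x} → Situation σ x → Situation (Segment-reverse σ) x
  Situation-reverse (inj₁ cov) = inj₁ cov
  Situation-reverse (inj₂ (inj₁ ab)) = inj₂ (inj₂ (inj₁ ab))
  Situation-reverse (inj₂ (inj₂ (inj₁ ba))) = inj₂ (inj₁ ba)
  Situation-reverse {L = L} {σ} (inj₂ (inj₂ (inj₂ (k , h , 0<k , k<L , budget , W)))) =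
    inj₂ (inj₂ (inj₂ (L ∸ k , h , m<n⇒0<n∸m k<L , ∸-monoʳ-< 0<k (<⇒≤ k<L) , budget ,
      castʷ (cong (Segment.at σ) (sym (m∸[m∸n]≡n (<⇒≤ k<L)))) refl refl W)))

module AlongPath {n : ℕ} {T : Rel n} (tree : IsTree T) {P : List (Fin n)} {u v : Fin n} (isP : IsPath T P u v) where
  open Tree tree

  σ : Segment T u v (length P ∸ 1)
  σ = path⇒Segment symmetric isP
  open Segment σ

  path-IsDist : IsDist T u v (length P ∸ 1)
  path-IsDist = castʷ at-0 at-L refl (between z≤n ≤-refl) , λ m → path-shortest P isP

  FarVertex : ℕ → Set
  FarVertex p = ∃[ x ] (¬ InT12 T P u v x × ∃[ duv ] ∃[ dPx ]
                  (IsDist T u v duv × IsDistToSet T P x dPx × duv + 2 * dPx ≥ 2 * p + 3))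

  module Burnt {p : ℕ} (burnsT′ : Burns (AdjT' T P u v) (InT12 T P u v) p) where
    open Reburning tree (proj₁ burnsT′)

    situation-T₁₂ : ∀ {x} → InT12 T P u v x → Situation σ x
    situation-T₁₂ x∈ with proj₂ (proj₂ burnsT′) _ x∈
    ... | i , m , m≤r , W with AdjT′-walk⇒ReachWithEdge W
    ... | inj₁ (k , k≤m , W′) = inj₁ (i , k , ≤-trans k≤m m≤r , W′)
    ... | inj₂ (inj₁ (m₁ , m₂ , le , W₁ , W₂)) =
      inj₂ (inj₁ (i , m₁ , m₂ , ≤-trans le m≤r , W₁ , W₂))
    ... | inj₂ (inj₂ (m₁ , m₂ , le , W₁ , W₂)) =
      inj₂ (inj₂ (inj₁ (i , m₁ , m₂ , ≤-trans le m≤r , W₁ , W₂)))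

    situation-outside : ¬ FarVertex p → ∀ {x} → ¬ InT12 T P u v x → OffPath σ x
    situation-outside no-far {x} x∉ with distToSet-exists (head⇒∈ P (proj₁ (proj₂ (proj₂ isP)))) x
    ... | h , (w , w∈P , W) , shortest with path⇒Segment-∈ symmetric isP w∈P
    ... | k , k≤L , at-k = k , h , n≢0⇒n>0 k≢0 , ≤∧≢⇒< k≤L k≢L , budget , castʷ (sym at-k) refl refl W
      where
      avoiding : ∀ {e} → ¬ Interior P u v e → Walk T Every e x h → InComp T P u v e x
      avoiding e∉ W = h , shortest-avoids (λ y∉P (y∈P , _) → y∉P y∈P) shortest e∉ W
      k≢0 : k ≢ 0
      k≢0 refl = x∉ (inj₁ (avoiding (λ (_ , u≢u , _) → u≢u refl) (castʷ (trans (sym at-k) at-0) refl refl W)))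
      k≢L : k ≢ length P ∸ 1
      k≢L refl = x∉ (inj₂ (avoiding (λ (_ , _ , v≢v) → v≢v refl) (castʷ (trans (sym at-k) at-L) refl refl W)))
      budget : length P ∸ 1 + 2 * h ≤ 2 * p + 2
      budget = s≤s⁻¹ (≤-trans (≰⇒> λ far → no-far (x , x∉ , _ , h , path-IsDist , ((w , w∈P , W) , shortest) , far))
                              (≤-reflexive (+-suc (2 * p) 2)))

    situation : ¬ FarVertex p → ∀ x → ¬ ¬ Situation σ x
    situation no-far x = ¬¬-map classify ¬¬-excluded-middle
      where
      classify : Dec (InT12 T P u v x) → Situation σ x
      classify (yes x∈) = situation-T₁₂ x∈
      classify (no x∉)  = inj₂ (inj₂ (inj₂ (situation-outside no-far x∉)))

lemma2p5 : {n : ℕ} (T : Rel n) → IsTree T →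
    (P : List (Fin n)) (u v : Fin n) → u ≢ v → IsPath T P u v →
    (p : ℕ) → BurningNumber (AdjT' T P u v) (InT12 T P u v) p →
    ¬ (∃[ x ] (¬ InT12 T P u v x × ∃[ duv ] ∃[ dPx ]
         (IsDist T u v duv × IsDistToSet T P x dPx × duv + 2 * dPx ≥ 2 * p + 3))) →
    BurningNumber≤ T Every (suc p)
lemma2p5 T tree P u v _ isP p (burnsT′ , _) no-far = suc p , ≤-refl , burns
  where
  open AlongPath tree isP
  open Burnt burnsT′
  open Reburning tree (proj₁ burnsT′)
  burns : Burns T Every (suc p)
  burns with slack v ≤? slack u
  ... | yes v≤u = burns-with-centre σ v≤u (situation no-far)
  ... | no v≰u  = burns-with-centre (Segment-reverse σ) (<⇒≤ (≰⇒> v≰u))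
                    (λ x → ¬¬-map (Situation-reverse {σ = σ}) (situation no-far x))
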